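{- For any positive odd integer $n$, \[ \sum_{k=0}^{n}(-1)^k(4k+1)\frac{\left(\frac{1}{2}\right)_k^3(-n)_k(n+1)_k}{(1)_k^3\left(n+\frac{3}{2}\right)_k\left(-n+\frac{1}{2}\right)_k}=0. \]
   Context: For a number $a$, the Pochhammer symbol is $(a)_0=1$ and $(a)_n=a(a+1)\cdots(a+n-1)$ for $n\ge 1$. -}

module Defs where

open import Data.Nat as ℕ using (ℕ; zero; suc)
open import Data.Integer as ℤ using (ℤ; +_)
open import Data.Rational as ℚ using (ℚ; 0ℚ; 1ℚ; _+_; _*_; -_; _÷_; ≢-nonZero)
open import Relation.Nullary using (yes; no)

poch : ℚ → ℕ → ℚ
poch a zero    = 1ℚ
poch a (suc n) = poch a n * (a + (+ n) ℚ./ 1)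

ℕtoℚ : ℕ → ℚ
ℕtoℚ n = (+ n) ℚ./ 1

-- total division: p / q when q ≠ 0, and 0 otherwise
-- (only used where the denominator is provably nonzero)
_/?_ : ℚ → ℚ → ℚ
p /? q with q ℚ.≟ 0ℚ
... | yes _ = 0ℚ
... | no q≢0 = _÷_ p q {{≢-nonZero q≢0}}

sgn : ℕ → ℚ
sgn zero    = 1ℚ
sgn (suc k) = - sgn k

sumTo : ℕ → (ℕ → ℚ) → ℚ
sumTo zero    f = f 0
sumTo (suc n) f = sumTo n f + f (suc n)

half : ℚ
half = (+ 1) ℚ./ 2

term : ℕ → ℕ → ℚ
term n k =
  sgn k * (ℕtoℚ (4 ℕ.* k ℕ.+ 1)) *
  ((poch half k * poch half k * poch half k * poch (- ℕtoℚ n) k * poch (ℕtoℚ n + 1ℚ) k)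
   /? (poch 1ℚ k * poch 1ℚ k * poch 1ℚ k * poch (ℕtoℚ n + ((+ 3) ℚ./ 2)) k * poch (- ℕtoℚ n + half) k))

-- Proof (Wilf–Zeilberger).  For every n ∈ ℕ, writing x = n and t_n(k) for the k-th
-- summand, the certificate
--   G(k) = (-1)^k c(x) R(x,k) V(x+2,k),   c(x) = -2(2x+1)(2x+3),
--   R(x,y) = y³ (y+x+5/2) / ((y+x+1)(y+x+2)(y-x-3/2))
-- satisfies  A(x) t_{n+2}(k) - C(x) t_n(k) = G(k+1) - G(k)  for all k, where
--   A(x) = (x+2)²(2x+1),   C(x) = (x+1)²(2x+5).
-- Summing over k ≤ n+2 (the summands t_n(n+1), t_n(n+2) vanish because (-n)_k does)
-- telescopes to  A·S(n+2) - C·S(n) = G(n+3) - G(0) = 0, so S(n) = 0 implies S(n+2) = 0.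
-- As S(1) = 1 - 1 = 0, induction on m proves the theorem.

module Submission where

open import Data.Nat as ℕ using (ℕ; zero; suc)
import Data.Nat.Properties as ℕP
open import Data.Integer as ℤ using (+_)
import Data.Integer.Properties as ℤP
open import Data.Rational as ℚ
  using (ℚ; 0ℚ; 1ℚ; _+_; _*_; -_; _-_; 1/_; toℚᵘ; ≢-nonZero; Positive; NonNegative)
open import Data.Rational.Properties
import Data.Rational.Unnormalised as U
import Data.Rational.Unnormalised.Properties as UP
open import Data.Rational.Solver using (module +-*-Solver)
open import Relation.Binary.PropositionalEquality
open import Relation.Nullary using (yes; no)
open import Data.Empty using (⊥-elim)
open import Defs
open +-*-Solver

ι : ℕ → ℚ
ι = ℕtoℚ

-- ι is additive; on unnormalised rationals this is a cross-multiplication in ℤ.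
ι-+ : ∀ a b → ι (a ℕ.+ b) ≡ ι a + ι b
ι-+ a b = toℚᵘ-injective (begin
  toℚᵘ (ι (a ℕ.+ b))          ≈⟨ toℚᵘ-fromℚᵘ (ιᵘ (a ℕ.+ b)) ⟩
  ιᵘ (a ℕ.+ b)                ≈⟨ U.*≡* cross ⟩
  ιᵘ a U.+ ιᵘ b               ≈⟨ UP.≃-sym (UP.+-cong (toℚᵘ-fromℚᵘ (ιᵘ a)) (toℚᵘ-fromℚᵘ (ιᵘ b))) ⟩
  toℚᵘ (ι a) U.+ toℚᵘ (ι b)   ≈⟨ UP.≃-sym (toℚᵘ-homo-+ (ι a) (ι b)) ⟩
  toℚᵘ (ι a + ι b)            ∎)
  where
  open UP.≃-Reasoning
  ιᵘ : ℕ → U.ℚᵘ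
  ιᵘ c = U.mkℚᵘ (+ c) 0
  cross : + (a ℕ.+ b) ℤ.* + 1 ≡ (+ a ℤ.* + 1 ℤ.+ + b ℤ.* + 1) ℤ.* + 1
  cross = trans (ℤP.*-identityʳ _) (trans (ℤP.pos-+ a b) (sym (trans (ℤP.*-identityʳ _)
            (cong₂ ℤ._+_ (ℤP.*-identityʳ (+ a)) (ℤP.*-identityʳ (+ b))))))

ι-suc : ∀ k → ι (suc k) ≡ ι k + 1ℚ
ι-suc k = trans (ι-+ 1 k) (+-comm 1ℚ (ι k))

ι-* : ∀ a b → ι (a ℕ.* b) ≡ ι a * ι b
ι-* zero    b = sym (*-zeroˡ (ι b))
ι-* (suc a) b = begin
  ι (b ℕ.+ a ℕ.* b)       ≡⟨ ι-+ b (a ℕ.* b) ⟩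
  ι b + ι (a ℕ.* b)       ≡⟨ cong (λ z → ι b + z) (ι-* a b) ⟩
  ι b + ι a * ι b         ≡⟨ solve 2 (λ u v → v :+ u :* v := (u :+ con 1ℚ) :* v) refl (ι a) (ι b) ⟩
  (ι a + 1ℚ) * ι b        ≡⟨ cong (_* ι b) (sym (ι-suc a)) ⟩
  ι (suc a) * ι b         ∎
  where open ≡-Reasoning

ι-nonNeg : ∀ a → NonNegative (ι a)
ι-nonNeg a = normalize-nonNeg a 1

*-cancelʳ-≢0 : ∀ {a b} w → w ≢ 0ℚ → a * w ≡ b * w → a ≡ b
*-cancelʳ-≢0 {a} {b} w w≢0 eq = begin
  a                ≡⟨ sym (*-identityʳ a) ⟩
  a * 1ℚ           ≡⟨ cong (a *_) (sym (*-inverseʳ w)) ⟩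
  a * (w * 1/ w)   ≡⟨ sym (*-assoc a w _) ⟩
  a * w * 1/ w     ≡⟨ cong (_* 1/ w) eq ⟩
  b * w * 1/ w     ≡⟨ *-assoc b w _ ⟩
  b * (w * 1/ w)   ≡⟨ cong (b *_) (*-inverseʳ w) ⟩
  b * 1ℚ           ≡⟨ *-identityʳ b ⟩
  b                ∎
  where
  open ≡-Reasoning
  instance _ = ≢-nonZero w≢0

*-≢0 : ∀ {a b} → a ≢ 0ℚ → b ≢ 0ℚ → a * b ≢ 0ℚ
*-≢0 {a} {b} a≢0 b≢0 ab≡0 = a≢0 (*-cancelʳ-≢0 b b≢0 (trans ab≡0 (sym (*-zeroˡ b))))

≢0-resp-≡ : ∀ {a b} → a ≡ b → b ≢ 0ℚ → a ≢ 0ℚ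
≢0-resp-≡ a≡b b≢0 a≡0 = b≢0 (trans (sym a≡b) a≡0)

pos⇒≢0 : ∀ p → .{{Positive p}} → p ≢ 0ℚ
pos⇒≢0 p p≡0 = <-irrefl (sym p≡0) (positive⁻¹ p)

nonNeg+pos≢0 : ∀ p .{{_ : NonNegative p}} c .{{_ : Positive c}} → p + c ≢ 0ℚ
nonNeg+pos≢0 p c = pos⇒≢0 (p + c) {{nonNeg+pos⇒pos p c}}

/?-cancel : ∀ p {q} → q ≢ 0ℚ → (p /? q) * q ≡ p
/?-cancel p {q} q≢0 with q ℚ.≟ 0ℚ
... | yes q≡0 = ⊥-elim (q≢0 q≡0)
... | no q≢0′ = begin
  p * 1/ q * q      ≡⟨ *-assoc p _ q ⟩
  p * (1/ q * q)    ≡⟨ cong (p *_) (*-inverseˡ q) ⟩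
  p * 1ℚ            ≡⟨ *-identityʳ p ⟩
  p                 ∎
  where
  open ≡-Reasoning
  instance _ = ≢-nonZero q≢0′

0/?≡0 : ∀ {p} q → p ≡ 0ℚ → p /? q ≡ 0ℚ
0/?≡0 {p} q p≡0 with q ℚ.≟ 0ℚ
... | yes _   = refl
... | no q≢0′ = trans (cong (_* 1/ q) p≡0) (*-zeroˡ (1/ q))
  where instance _ = ≢-nonZero q≢0′

/?-cross : ∀ N D N′ D′ u v → D ≢ 0ℚ → D′ ≢ 0ℚ →
           N * D′ * u ≡ N′ * D * v → (N /? D) * u ≡ (N′ /? D′) * v
/?-cross N D N′ D′ u v D≢0 D′≢0 eq = *-cancelʳ-≢0 (D * D′) (*-≢0 D≢0 D′≢0) (begin
  X * u * (D * D′)   ≡⟨ solve 4 (λ X u D D′ → X :* u :* (D :* D′) := X :* D :* D′ :* u) refl X u D D′ ⟩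
  X * D * D′ * u     ≡⟨ cong (λ z → z * D′ * u) (/?-cancel N D≢0) ⟩
  N * D′ * u         ≡⟨ eq ⟩
  N′ * D * v         ≡⟨ cong (λ z → z * D * v) (sym (/?-cancel N′ D′≢0)) ⟩
  Y * D′ * D * v     ≡⟨ solve 4 (λ Y v D D′ → Y :* D′ :* D :* v := Y :* v :* (D :* D′)) refl Y v D D′ ⟩
  Y * v * (D * D′)   ∎)
  where
  open ≡-Reasoning
  X = N /? D
  Y = N′ /? D′

sum-telescope : ∀ K (a c : ℚ) (f g G : ℕ → ℚ) →
                (∀ k → a * f k - c * g k ≡ G (suc k) - G k) →
                a * sumTo K f - c * sumTo K g ≡ G (suc K) - G 0
sum-telescope zero    a c f g G step = step 0
sum-telescope (suc K) a c f g G step = begin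
  a * (F + f (suc K)) - c * (Γ + g (suc K))
    ≡⟨ solve 6 (λ a c F Γ u v → a :* (F :+ u) :- c :* (Γ :+ v) := (a :* F :- c :* Γ) :+ (a :* u :- c :* v))
               refl a c F Γ (f (suc K)) (g (suc K)) ⟩
  (a * F - c * Γ) + (a * f (suc K) - c * g (suc K))
    ≡⟨ cong₂ _+_ (sum-telescope K a c f g G step) (step (suc K)) ⟩
  (G (suc K) - G 0) + (G (suc (suc K)) - G (suc K))
    ≡⟨ solve 3 (λ u v w → (v :- u) :+ (w :- v) := w :- u) refl (G 0) (G (suc K)) (G (suc (suc K))) ⟩
  G (suc (suc K)) - G 0 ∎
  where
  open ≡-Reasoning
  F = sumTo K f
  Γ = sumTo K g

poch-shift : ∀ c k → poch (c + 1ℚ) k * c ≡ poch c k * (c + ι k)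
poch-shift c zero = solve 1 (λ c → con 1ℚ :* c := con 1ℚ :* (c :+ con 0ℚ)) refl c
poch-shift c (suc k) = begin
  poch (c + 1ℚ) k * (c + 1ℚ + ι k) * c   ≡⟨ solve 3 (λ P c y → P :* (c :+ con 1ℚ :+ y) :* c := P :* c :* (c :+ con 1ℚ :+ y)) refl (poch (c + 1ℚ) k) c (ι k) ⟩
  poch (c + 1ℚ) k * c * (c + 1ℚ + ι k)   ≡⟨ cong (_* (c + 1ℚ + ι k)) (poch-shift c k) ⟩
  poch c k * (c + ι k) * (c + 1ℚ + ι k)  ≡⟨ cong (poch c k * (c + ι k) *_) (solve 2 (λ c y → c :+ con 1ℚ :+ y := c :+ (y :+ con 1ℚ)) refl c (ι k)) ⟩
  poch c k * (c + ι k) * (c + (ι k + 1ℚ)) ≡⟨ cong (λ z → poch c k * (c + ι k) * (c + z)) (sym (ι-suc k)) ⟩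
  poch c k * (c + ι k) * (c + ι (suc k)) ∎
  where open ≡-Reasoning

pair : ℚ → ℚ
pair c = c * (c + 1ℚ)

poch-shift₂ : ∀ c {d} k → c + 1ℚ + 1ℚ ≡ d → poch d k * pair c ≡ poch c k * pair (c + ι k)
poch-shift₂ c k refl = begin
  poch (c + 1ℚ + 1ℚ) k * (c * (c + 1ℚ))   ≡⟨ solve 3 (λ P c c′ → P :* (c :* c′) := P :* c′ :* c) refl (poch (c + 1ℚ + 1ℚ) k) c (c + 1ℚ) ⟩
  poch (c + 1ℚ + 1ℚ) k * (c + 1ℚ) * c     ≡⟨ cong (_* c) (poch-shift (c + 1ℚ) k) ⟩
  poch (c + 1ℚ) k * (c + 1ℚ + ι k) * c    ≡⟨ solve 3 (λ P c z → P :* z :* c := P :* c :* z) refl (poch (c + 1ℚ) k) c (c + 1ℚ + ι k) ⟩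
  poch (c + 1ℚ) k * c * (c + 1ℚ + ι k)    ≡⟨ cong (_* (c + 1ℚ + ι k)) (poch-shift c k) ⟩
  poch c k * (c + ι k) * (c + 1ℚ + ι k)   ≡⟨ solve 3 (λ P c y → P :* (c :+ y) :* (c :+ con 1ℚ :+ y) := P :* ((c :+ y) :* ((c :+ y) :+ con 1ℚ))) refl (poch c k) c (ι k) ⟩
  poch c k * pair (c + ι k)               ∎
  where open ≡-Reasoning

poch-vanish : ∀ m j → poch (- ι m) (j ℕ.+ suc m) ≡ 0ℚ
poch-vanish m zero    = trans (cong (poch (- ι m) m *_) (+-inverseˡ (ι m))) (*-zeroʳ (poch (- ι m) m))
poch-vanish m (suc j) = trans (cong (_* (- ι m + ι (j ℕ.+ suc m))) (poch-vanish m j)) (*-zeroˡ (- ι m + ι (j ℕ.+ suc m)))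

poch-≢0 : ∀ a k → (∀ j → a + ι j ≢ 0ℚ) → poch a k ≢ 0ℚ
poch-≢0 a zero    _    = λ ()
poch-≢0 a (suc k) a+j≢0 = *-≢0 (poch-≢0 a k a+j≢0) (a+j≢0 k)

poch-pos-≢0 : ∀ c .{{_ : Positive c}} k → poch c k ≢ 0ℚ
poch-pos-≢0 c k = poch-≢0 c k (λ j → pos⇒≢0 (c + ι j) {{pos+nonNeg⇒pos c (ι j) {{ι-nonNeg j}}}})

half-odd-≢0 : ∀ a b → ι a - ι b + half ≢ 0ℚ
half-odd-≢0 zero    zero    = λ ()
half-odd-≢0 (suc a) (suc b) = ≢0-resp-≡ (begin
    ι (suc a) - ι (suc b) + half     ≡⟨ cong₂ (λ u v → u - v + half) (ι-suc a) (ι-suc b) ⟩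
    ι a + 1ℚ - (ι b + 1ℚ) + half     ≡⟨ solve 3 (λ u v h → u :+ con 1ℚ :- (v :+ con 1ℚ) :+ h := u :- v :+ h) refl (ι a) (ι b) half ⟩
    ι a - ι b + half                 ∎) (half-odd-≢0 a b)
  where open ≡-Reasoning
half-odd-≢0 (suc a) zero    = ≢0-resp-≡ (solve 2 (λ u h → u :- con 0ℚ :+ h := u :+ h) refl (ι (suc a)) half)
                                        (nonNeg+pos≢0 (ι (suc a)) {{ι-nonNeg (suc a)}} half)
half-odd-≢0 zero    (suc b) = ≢0-resp-≡ (begin
    ι zero - ι (suc b) + half        ≡⟨ cong (λ v → ι zero - v + half) (ι-suc b) ⟩
    0ℚ - (ι b + 1ℚ) + half           ≡⟨ solve 1 (λ v → con 0ℚ :- (v :+ con 1ℚ) :+ con half := :- (v :+ con half)) refl (ι b) ⟩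
    - (ι b + half)                   ∎) (λ eq → nonNeg+pos≢0 (ι b) {{ι-nonNeg b}} half (neg-injective eq))
  where open ≡-Reasoning

2ℚ 3ℚ 4ℚ 5ℚ 3/2 5/2 : ℚ
2ℚ  = (+ 2) ℚ./ 1
3ℚ  = (+ 3) ℚ./ 1
4ℚ  = (+ 4) ℚ./ 1
5ℚ  = (+ 5) ℚ./ 1
3/2 = (+ 3) ℚ./ 2
5/2 = (+ 5) ℚ./ 2

hypNum hypDen : ℚ → ℕ → ℚ
hypNum x k = poch half k * poch half k * poch half k * poch (- x) k * poch (x + 1ℚ) k
hypDen x k = poch 1ℚ k * poch 1ℚ k * poch 1ℚ k * poch (x + 3/2) k * poch (- x + half) k

V : ℚ → ℕ → ℚ
V x k = hypNum x k /? hypDen x k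

weight : ℚ → ℚ
weight y = 4ℚ * y + 1ℚ

term≡V : ∀ n k → term n k ≡ sgn k * weight (ι k) * V (ι n) k
term≡V n k = cong (λ u → sgn k * u * V (ι n) k) (trans (ι-+ (4 ℕ.* k) 1) (cong (_+ 1ℚ) (ι-* 4 k)))

ι-+2 : ∀ n → ι (suc (suc n)) ≡ ι n + 2ℚ
ι-+2 n = trans (ι-+ 2 n) (+-comm 2ℚ (ι n))

hypNum-vanish : ∀ x k → poch (- x) k ≡ 0ℚ → hypNum x k ≡ 0ℚ
hypNum-vanish x k poch≡0 = trans (cong (λ z → poch half k * poch half k * poch half k * z * poch (x + 1ℚ) k) poch≡0)
  (solve 2 (λ h b → h :* h :* h :* con 0ℚ :* b := con 0ℚ) refl (poch half k) (poch (x + 1ℚ) k))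

term-vanish : ∀ n k → poch (- ι n) k ≡ 0ℚ → term n k ≡ 0ℚ
term-vanish n k poch≡0 = trans (term≡V n k)
  (trans (cong (sgn k * weight (ι k) *_) (0/?≡0 (hypDen (ι n) k) (hypNum-vanish (ι n) k poch≡0)))
         (*-zeroʳ (sgn k * weight (ι k))))

-- For a natural parameter the denominator never vanishes (its factors are positive or half-odd).
hypDen-≢0 : ∀ m k → hypDen (ι m) k ≢ 0ℚ
hypDen-≢0 m k = *-≢0 (*-≢0 (*-≢0 (*-≢0 ones ones) ones) (poch-pos-≢0 (ι m + 3/2) {{shifted-pos}} k))
                     (poch-≢0 (- ι m + half) k half-odd-factor)
  where
  ones : poch 1ℚ k ≢ 0ℚ
  ones = poch-pos-≢0 1ℚ k
  shifted-pos : Positive (ι m + 3/2)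
  shifted-pos = nonNeg+pos⇒pos (ι m) {{ι-nonNeg m}} 3/2
  half-odd-factor : ∀ j → - ι m + half + ι j ≢ 0ℚ
  half-odd-factor j = ≢0-resp-≡ (solve 2 (λ u v → :- u :+ con half :+ v := v :- u :+ con half) refl (ι m) (ι j)) (half-odd-≢0 j m)

hypDen₂-≢0 : ∀ n k → hypDen (ι n + 2ℚ) k ≢ 0ℚ
hypDen₂-≢0 n k = ≢0-resp-≡ (cong (λ z → hypDen z k) (sym (ι-+2 n))) (hypDen-≢0 (suc (suc n)) k)

-- Contiguity in the parameter: V(x,k)·P(x,k) = V(x+2,k)·Q(x,k)

contigP contigQ : ℚ → ℚ → ℚ
contigP x y = (y + x + 1ℚ) * (y + x + 2ℚ) * (x + 5/2) * (y - x - 3/2) * (y - x - half)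
contigQ x y = (y - x - 2ℚ) * (y - x - 1ℚ) * (y + x + 3/2) * (y + x + 5/2) * (x + half)

-- The common factor cleared in the contiguity relation.
contigW : ℚ → ℚ
contigW x = (x + 1ℚ) * (x + 2ℚ) * (x + 3/2)

-- The relation with denominators cleared: each parameter of V(x+2,·) differs from the
-- corresponding one of V(x,·) by ±2, and poch-shift₂ trades the four shifts for pairs.
contiguity-cleared : ∀ x k →
  hypNum x k * hypDen (x + 2ℚ) k * (contigP x (ι k) * contigW x) ≡
  hypNum (x + 2ℚ) k * hypDen x k * (contigQ x (ι k) * contigW x)
contiguity-cleared x k = begin
  hypNum x k * hypDen (x + 2ℚ) k * (contigP x y * contigW x)
    ≡⟨ cong (hypNum x k * hypDen (x + 2ℚ) k *_) (P-pairs x y) ⟩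
  hypNum x k * hypDen (x + 2ℚ) k * (pair c₁ * pair (c₂ + y) * pair c₃ * pair (c₄ + y))
    ≡⟨ regroup h o (poch (- x) k) (poch c₂ k) (poch (x + 2ℚ + 3/2) k) (poch c₄ k) (pair c₁) (pair (c₂ + y)) (pair c₃) (pair (c₄ + y)) ⟩
  h³o³ * ((poch (- x) k * pair c₁) * (poch c₂ k * pair (c₂ + y)) * (poch (x + 2ℚ + 3/2) k * pair c₃) * (poch c₄ k * pair (c₄ + y)))
    ≡⟨ cong₂ (λ u v → h³o³ * (u * v * (poch (x + 2ℚ + 3/2) k * pair c₃) * (poch c₄ k * pair (c₄ + y)))) shift₁ (sym shift₂) ⟩
  h³o³ * ((poch c₁ k * pair (c₁ + y)) * (poch (x + 2ℚ + 1ℚ) k * pair c₂) * (poch (x + 2ℚ + 3/2) k * pair c₃) * (poch c₄ k * pair (c₄ + y)))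
    ≡⟨ cong₂ (λ u v → h³o³ * ((poch c₁ k * pair (c₁ + y)) * (poch (x + 2ℚ + 1ℚ) k * pair c₂) * u * v)) shift₃ (sym shift₄) ⟩
  h³o³ * ((poch c₁ k * pair (c₁ + y)) * (poch (x + 2ℚ + 1ℚ) k * pair c₂) * (poch c₃ k * pair (c₃ + y)) * (poch (- x + half) k * pair c₄))
    ≡⟨ sym (regroup h o (poch c₁ k) (poch (x + 2ℚ + 1ℚ) k) (poch c₃ k) (poch (- x + half) k) (pair (c₁ + y)) (pair c₂) (pair (c₃ + y)) (pair c₄)) ⟩
  hypNum (x + 2ℚ) k * hypDen x k * (pair (c₁ + y) * pair c₂ * pair (c₃ + y) * pair c₄)
    ≡⟨ cong (hypNum (x + 2ℚ) k * hypDen x k *_) (sym (Q-pairs x y)) ⟩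
  hypNum (x + 2ℚ) k * hypDen x k * (contigQ x y * contigW x) ∎
  where
  open ≡-Reasoning
  y = ι k
  h = poch half k
  o = poch 1ℚ k
  h³o³ = h * h * h * (o * o * o)
  c₁ = - (x + 2ℚ)
  c₂ = x + 1ℚ
  c₃ = x + 3/2
  c₄ = - (x + 2ℚ) + half
  P-pairs : ∀ x y → contigP x y * contigW x ≡
    pair (- (x + 2ℚ)) * pair (x + 1ℚ + y) * pair (x + 3/2) * pair (- (x + 2ℚ) + half + y)
  P-pairs = solve 2 (λ x y →
    (y :+ x :+ con 1ℚ) :* (y :+ x :+ con 2ℚ) :* (x :+ con 5/2) :* (y :- x :- con 3/2) :* (y :- x :- con half)
      :* ((x :+ con 1ℚ) :* (x :+ con 2ℚ) :* (x :+ con 3/2))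
    := ((:- (x :+ con 2ℚ)) :* (:- (x :+ con 2ℚ) :+ con 1ℚ))
      :* ((x :+ con 1ℚ :+ y) :* (x :+ con 1ℚ :+ y :+ con 1ℚ))
      :* ((x :+ con 3/2) :* (x :+ con 3/2 :+ con 1ℚ))
      :* ((:- (x :+ con 2ℚ) :+ con half :+ y) :* (:- (x :+ con 2ℚ) :+ con half :+ y :+ con 1ℚ))) refl
  Q-pairs : ∀ x y → contigQ x y * contigW x ≡
    pair (- (x + 2ℚ) + y) * pair (x + 1ℚ) * pair (x + 3/2 + y) * pair (- (x + 2ℚ) + half)
  Q-pairs = solve 2 (λ x y →
    (y :- x :- con 2ℚ) :* (y :- x :- con 1ℚ) :* (y :+ x :+ con 3/2) :* (y :+ x :+ con 5/2) :* (x :+ con half)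
      :* ((x :+ con 1ℚ) :* (x :+ con 2ℚ) :* (x :+ con 3/2))
    := ((:- (x :+ con 2ℚ) :+ y) :* (:- (x :+ con 2ℚ) :+ y :+ con 1ℚ))
      :* ((x :+ con 1ℚ) :* (x :+ con 1ℚ :+ con 1ℚ))
      :* ((x :+ con 3/2 :+ y) :* (x :+ con 3/2 :+ y :+ con 1ℚ))
      :* ((:- (x :+ con 2ℚ) :+ con half) :* (:- (x :+ con 2ℚ) :+ con half :+ con 1ℚ))) refl
  regroup : ∀ h o a₁ a₂ b₁ b₂ p₁ p₂ p₃ p₄ →
    (h * h * h * a₁ * a₂) * (o * o * o * b₁ * b₂) * (p₁ * p₂ * p₃ * p₄) ≡
    h * h * h * (o * o * o) * ((a₁ * p₁) * (a₂ * p₂) * (b₁ * p₃) * (b₂ * p₄))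
  regroup = solve 10 (λ h o a₁ a₂ b₁ b₂ p₁ p₂ p₃ p₄ →
    (h :* h :* h :* a₁ :* a₂) :* (o :* o :* o :* b₁ :* b₂) :* (p₁ :* p₂ :* p₃ :* p₄)
    := h :* h :* h :* (o :* o :* o) :* ((a₁ :* p₁) :* (a₂ :* p₂) :* (b₁ :* p₃) :* (b₂ :* p₄))) refl
  shift₁ : poch (- x) k * pair c₁ ≡ poch c₁ k * pair (c₁ + y)
  shift₁ = poch-shift₂ c₁ k (solve 1 (λ x → :- (x :+ con 2ℚ) :+ con 1ℚ :+ con 1ℚ := :- x) refl x)
  shift₂ : poch (x + 2ℚ + 1ℚ) k * pair c₂ ≡ poch c₂ k * pair (c₂ + y)
  shift₂ = poch-shift₂ c₂ k (solve 1 (λ x → x :+ con 1ℚ :+ con 1ℚ :+ con 1ℚ := x :+ con 2ℚ :+ con 1ℚ) refl x)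
  shift₃ : poch (x + 2ℚ + 3/2) k * pair c₃ ≡ poch c₃ k * pair (c₃ + y)
  shift₃ = poch-shift₂ c₃ k (solve 1 (λ x → x :+ con 3/2 :+ con 1ℚ :+ con 1ℚ := x :+ con 2ℚ :+ con 3/2) refl x)
  shift₄ : poch (- x + half) k * pair c₄ ≡ poch c₄ k * pair (c₄ + y)
  shift₄ = poch-shift₂ c₄ k (solve 1 (λ x → :- (x :+ con 2ℚ) :+ con half :+ con 1ℚ :+ con 1ℚ := :- x :+ con half) refl x)

contiguity : ∀ n k → V (ι n) k * contigP (ι n) (ι k) ≡ V (ι n + 2ℚ) k * contigQ (ι n) (ι k)
contiguity n k = /?-cross (hypNum x k) (hypDen x k) (hypNum x₂ k) (hypDen x₂ k) P Q
  (hypDen-≢0 n k) (hypDen₂-≢0 n k) (*-cancelʳ-≢0 (contigW x) W≢0 (begin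
    hypNum x k * hypDen x₂ k * P * contigW x     ≡⟨ *-assoc (hypNum x k * hypDen x₂ k) P (contigW x) ⟩
    hypNum x k * hypDen x₂ k * (P * contigW x)   ≡⟨ contiguity-cleared x k ⟩
    hypNum x₂ k * hypDen x k * (Q * contigW x)   ≡⟨ sym (*-assoc (hypNum x₂ k * hypDen x k) Q (contigW x)) ⟩
    hypNum x₂ k * hypDen x k * Q * contigW x     ∎))
  where
  open ≡-Reasoning
  x = ι n
  x₂ = x + 2ℚ
  P = contigP x (ι k)
  Q = contigQ x (ι k)
  W≢0 : contigW x ≢ 0ℚ
  W≢0 = *-≢0 (*-≢0 (nonNeg+pos≢0 x {{ι-nonNeg n}} 1ℚ) (nonNeg+pos≢0 x {{ι-nonNeg n}} 2ℚ))
             (nonNeg+pos≢0 x {{ι-nonNeg n}} 3/2)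

-- V(x,k+1)/V(x,k) = ratioNum x k / ratioDen x k.
ratioNum ratioDen : ℚ → ℕ → ℚ
ratioNum x k = (half + ι k) * (half + ι k) * (half + ι k) * (- x + ι k) * (x + 1ℚ + ι k)
ratioDen x k = (1ℚ + ι k) * (1ℚ + ι k) * (1ℚ + ι k) * (x + 3/2 + ι k) * (- x + half + ι k)

advance : ∀ p a b u₁ u₂ u₃ u₄ u₅ →
  p * u₁ * (p * u₂) * (p * u₃) * (a * u₄) * (b * u₅) ≡ p * p * p * a * b * (u₁ * u₂ * u₃ * u₄ * u₅)
advance = solve 8 (λ p a b u₁ u₂ u₃ u₄ u₅ →
  p :* u₁ :* (p :* u₂) :* (p :* u₃) :* (a :* u₄) :* (b :* u₅) := p :* p :* p :* a :* b :* (u₁ :* u₂ :* u₃ :* u₄ :* u₅)) refl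

hypNum-suc : ∀ x k → hypNum x (suc k) ≡ hypNum x k * ratioNum x k
hypNum-suc x k = advance (poch half k) (poch (- x) k) (poch (x + 1ℚ) k) _ _ _ _ _

hypDen-suc : ∀ x k → hypDen x (suc k) ≡ hypDen x k * ratioDen x k
hypDen-suc x k = advance (poch 1ℚ k) (poch (x + 3/2) k) (poch (- x + half) k) _ _ _ _ _

-- The WZ certificate  R(x,k)·V(x+2,k),  R(x,y) = certNum x y / certDen x y

certNum certDen : ℚ → ℚ → ℚ
certNum x y = y * y * y * (y + x + 5/2)
certDen x y = (y + x + 1ℚ) * (y + x + 2ℚ) * (y - x - 3/2)

cert : ℚ → ℕ → ℚ
cert x k = (certNum x (ι k) * hypNum (x + 2ℚ) k) /? (certDen x (ι k) * hypDen (x + 2ℚ) k)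

cert-now : ∀ x k → certDen x (ι k) ≢ 0ℚ → hypDen (x + 2ℚ) k ≢ 0ℚ →
           cert x k * certDen x (ι k) ≡ V (x + 2ℚ) k * certNum x (ι k)
cert-now x k den≢0 hypDen≢0 = /?-cross _ _ _ _ _ _ (*-≢0 den≢0 hypDen≢0) hypDen≢0
  (solve 4 (λ c N D e → c :* N :* D :* e := N :* (e :* D) :* c) refl (certNum x y) (hypNum (x + 2ℚ) k) (hypDen (x + 2ℚ) k) (certDen x y))
  where y = ι k

-- The shifted certificate against V(x+2,k):  cert(x,k+1)·nextDen = V(x+2,k)·nextNum,
-- combining R(x,k+1) with the term ratio of V(x+2,·).
nextNum nextDen : ℚ → ℚ → ℚ
nextNum x y = (y + half) * (y + half) * (y + half) * (y - x - 2ℚ)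
nextDen x y = (y + x + 2ℚ) * (y - x - half) * (y - x - 3/2)

cert-next : ∀ x k → certDen x (ι (suc k)) ≢ 0ℚ → hypDen (x + 2ℚ) (suc k) ≢ 0ℚ → hypDen (x + 2ℚ) k ≢ 0ℚ →
            cert x (suc k) * nextDen x (ι k) ≡ V (x + 2ℚ) k * nextNum x (ι k)
cert-next x k den≢0 hypDen′≢0 hypDen≢0 = /?-cross _ _ _ _ _ _ (*-≢0 den≢0 hypDen′≢0) hypDen≢0 (begin
  certNum x y′ * hypNum X (suc k) * hypDen X k * nextDen x y
    ≡⟨ cong₂ (λ u v → certNum x u * v * hypDen X k * nextDen x y) (ι-suc k) (hypNum-suc X k) ⟩
  certNum x (y + 1ℚ) * (hypNum X k * ratioNum X k) * hypDen X k * nextDen x y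
    ≡⟨ clear-ratio x y (hypNum X k) (hypDen X k) ⟩
  hypNum X k * (certDen x (y + 1ℚ) * (hypDen X k * ratioDen X k)) * nextNum x y
    ≡⟨ cong₂ (λ u v → hypNum X k * (certDen x u * v) * nextNum x y) (sym (ι-suc k)) (sym (hypDen-suc X k)) ⟩
  hypNum X k * (certDen x y′ * hypDen X (suc k)) * nextNum x y ∎)
  where
  open ≡-Reasoning
  X = x + 2ℚ
  y = ι k
  y′ = ι (suc k)
  clear-ratio : ∀ x y N D →
    certNum x (y + 1ℚ) * (N * ((half + y) * (half + y) * (half + y) * (- (x + 2ℚ) + y) * (x + 2ℚ + 1ℚ + y))) * D * nextDen x y
    ≡ N * (certDen x (y + 1ℚ) * (D * ((1ℚ + y) * (1ℚ + y) * (1ℚ + y) * (x + 2ℚ + 3/2 + y) * (- (x + 2ℚ) + half + y)))) * nextNum x y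
  clear-ratio = solve 4 (λ x y N D →
    (y :+ con 1ℚ) :* (y :+ con 1ℚ) :* (y :+ con 1ℚ) :* (y :+ con 1ℚ :+ x :+ con 5/2)
      :* (N :* ((con half :+ y) :* (con half :+ y) :* (con half :+ y) :* (:- (x :+ con 2ℚ) :+ y) :* (x :+ con 2ℚ :+ con 1ℚ :+ y)))
      :* D :* ((y :+ x :+ con 2ℚ) :* (y :- x :- con half) :* (y :- x :- con 3/2))
    := N :* ((y :+ con 1ℚ :+ x :+ con 1ℚ) :* (y :+ con 1ℚ :+ x :+ con 2ℚ) :* (y :+ con 1ℚ :- x :- con 3/2)
           :* (D :* ((con 1ℚ :+ y) :* (con 1ℚ :+ y) :* (con 1ℚ :+ y) :* (x :+ con 2ℚ :+ con 3/2 :+ y) :* (:- (x :+ con 2ℚ) :+ con half :+ y))))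
      :* ((y :+ con half) :* (y :+ con half) :* (y :+ con half) :* (y :- x :- con 2ℚ))) refl

-- Coefficients of the recurrence  A(x)·S(x+2) = C(x)·S(x)  and the certificate constant c(x).
recA recC certC : ℚ → ℚ
recA x  = (x + 2ℚ) * (x + 2ℚ) * (2ℚ * x + 1ℚ)
recC x  = (x + 1ℚ) * (x + 1ℚ) * (2ℚ * x + 5ℚ)
certC x = (- 2ℚ) * (2ℚ * x + 1ℚ) * (2ℚ * x + 3ℚ)

-- The combination of the summands and certificates that must vanish, at a single k;
-- here V₀ = V(x,k), V₂ = V(x+2,k), H = cert(x,k), H′ = cert(x,k+1).
wz-defect : ℚ → ℚ → ℚ → ℚ → ℚ → ℚ → ℚ
wz-defect x y V₀ V₂ H H′ = recA x * weight y * V₂ - recC x * weight y * V₀ + certC x * H′ + certC x * H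

-- After expressing V₀, H, H′ through V₂, the defect is V₂ times a rational function of
-- (x,y) which vanishes identically; multiplied by contigP it is the following polynomial.
wz-polynomial : ∀ x y →
  recA x * weight y * contigP x y - recC x * weight y * contigQ x y
  + certC x * nextNum x y * ((y + x + 1ℚ) * (x + 5/2))
  + certC x * certNum x y * ((x + 5/2) * (y - x - half)) ≡ 0ℚ
wz-polynomial = solve 2 (λ x y →
  let A = (x :+ con 2ℚ) :* (x :+ con 2ℚ) :* (con 2ℚ :* x :+ con 1ℚ)
      C = (x :+ con 1ℚ) :* (x :+ con 1ℚ) :* (con 2ℚ :* x :+ con 5ℚ)
      c = (:- con 2ℚ) :* (con 2ℚ :* x :+ con 1ℚ) :* (con 2ℚ :* x :+ con 3ℚ)
      w = con 4ℚ :* y :+ con 1ℚ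
      P = (y :+ x :+ con 1ℚ) :* (y :+ x :+ con 2ℚ) :* (x :+ con 5/2) :* (y :- x :- con 3/2) :* (y :- x :- con half)
      Q = (y :- x :- con 2ℚ) :* (y :- x :- con 1ℚ) :* (y :+ x :+ con 3/2) :* (y :+ x :+ con 5/2) :* (x :+ con half)
      a = (y :+ con half) :* (y :+ con half) :* (y :+ con half) :* (y :- x :- con 2ℚ)
      m = y :* y :* y :* (y :+ x :+ con 5/2)
  in A :* w :* P :- C :* w :* Q :+ c :* a :* ((y :+ x :+ con 1ℚ) :* (x :+ con 5/2)) :+ c :* m :* ((x :+ con 5/2) :* (y :- x :- con half))
     := con 0ℚ) refl

wz-defect≡0 : ∀ x y V₀ V₂ H H′ →
  V₀ * contigP x y ≡ V₂ * contigQ x y →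
  H′ * nextDen x y ≡ V₂ * nextNum x y →
  H * certDen x y ≡ V₂ * certNum x y →
  contigP x y ≢ 0ℚ → wz-defect x y V₀ V₂ H H′ ≡ 0ℚ
wz-defect≡0 x y V₀ V₂ H H′ contig next now P≢0 = *-cancelʳ-≢0 (contigP x y) P≢0 (begin
  wz-defect x y V₀ V₂ H H′ * P
    ≡⟨ expand x y V₀ V₂ H H′ ⟩
  A * w * V₂ * P - C * w * (V₀ * P) + c * (H′ * nextDen x y) * ℓ₁ + c * (H * certDen x y) * ℓ₂
    ≡⟨ cong₂ (λ u v → A * w * V₂ * P - C * w * u + c * v * ℓ₁ + c * (H * certDen x y) * ℓ₂) contig next ⟩
  A * w * V₂ * P - C * w * (V₂ * Q) + c * (V₂ * nextNum x y) * ℓ₁ + c * (H * certDen x y) * ℓ₂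
    ≡⟨ cong (λ u → A * w * V₂ * P - C * w * (V₂ * Q) + c * (V₂ * nextNum x y) * ℓ₁ + c * u * ℓ₂) now ⟩
  A * w * V₂ * P - C * w * (V₂ * Q) + c * (V₂ * nextNum x y) * ℓ₁ + c * (V₂ * certNum x y) * ℓ₂
    ≡⟨ factor-V₂ A C c w P Q (nextNum x y) (certNum x y) ℓ₁ ℓ₂ V₂ ⟩
  V₂ * (A * w * P - C * w * Q + c * nextNum x y * ℓ₁ + c * certNum x y * ℓ₂)
    ≡⟨ cong (V₂ *_) (wz-polynomial x y) ⟩
  V₂ * 0ℚ
    ≡⟨ trans (*-zeroʳ V₂) (sym (*-zeroˡ P)) ⟩
  0ℚ * P ∎)
  where
  open ≡-Reasoning
  A = recA x
  C = recC x
  c = certC x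
  w = weight y
  P = contigP x y
  Q = contigQ x y
  ℓ₁ = (y + x + 1ℚ) * (x + 5/2)
  ℓ₂ = (x + 5/2) * (y - x - half)
  -- contigP is divisible by both nextDen and certDen, with cofactors ℓ₁ and ℓ₂.
  expand : ∀ x y V₀ V₂ H H′ → wz-defect x y V₀ V₂ H H′ * contigP x y ≡
    recA x * weight y * V₂ * contigP x y - recC x * weight y * (V₀ * contigP x y)
    + certC x * (H′ * nextDen x y) * ((y + x + 1ℚ) * (x + 5/2))
    + certC x * (H * certDen x y) * ((x + 5/2) * (y - x - half))
  expand = solve 6 (λ x y V₀ V₂ H H′ →
    let A = (x :+ con 2ℚ) :* (x :+ con 2ℚ) :* (con 2ℚ :* x :+ con 1ℚ)
        C = (x :+ con 1ℚ) :* (x :+ con 1ℚ) :* (con 2ℚ :* x :+ con 5ℚ)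
        c = (:- con 2ℚ) :* (con 2ℚ :* x :+ con 1ℚ) :* (con 2ℚ :* x :+ con 3ℚ)
        w = con 4ℚ :* y :+ con 1ℚ
        P = (y :+ x :+ con 1ℚ) :* (y :+ x :+ con 2ℚ) :* (x :+ con 5/2) :* (y :- x :- con 3/2) :* (y :- x :- con half)
        e = (y :+ x :+ con 2ℚ) :* (y :- x :- con half) :* (y :- x :- con 3/2)
        d = (y :+ x :+ con 1ℚ) :* (y :+ x :+ con 2ℚ) :* (y :- x :- con 3/2)
    in (A :* w :* V₂ :- C :* w :* V₀ :+ c :* H′ :+ c :* H) :* P
       := A :* w :* V₂ :* P :- C :* w :* (V₀ :* P) :+ c :* (H′ :* e) :* ((y :+ x :+ con 1ℚ) :* (x :+ con 5/2))
          :+ c :* (H :* d) :* ((x :+ con 5/2) :* (y :- x :- con half))) refl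
  factor-V₂ : ∀ A C c w P Q a m ℓ₁ ℓ₂ V₂ →
    A * w * V₂ * P - C * w * (V₂ * Q) + c * (V₂ * a) * ℓ₁ + c * (V₂ * m) * ℓ₂ ≡
    V₂ * (A * w * P - C * w * Q + c * a * ℓ₁ + c * m * ℓ₂)
  factor-V₂ = solve 11 (λ A C c w P Q a m ℓ₁ ℓ₂ V₂ →
    A :* w :* V₂ :* P :- C :* w :* (V₂ :* Q) :+ c :* (V₂ :* a) :* ℓ₁ :+ c :* (V₂ :* m) :* ℓ₂
    := V₂ :* (A :* w :* P :- C :* w :* Q :+ c :* a :* ℓ₁ :+ c :* m :* ℓ₂)) refl

sum-≢0 : ∀ n k c .{{_ : Positive c}} → ι k + ι n + c ≢ 0ℚ
sum-≢0 n k c = nonNeg+pos≢0 (ι k + ι n) {{nonNeg+nonNeg⇒nonNeg (ι k) {{ι-nonNeg k}} (ι n) {{ι-nonNeg n}}}} c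

diff-half-≢0 : ∀ n k → ι k - ι n - half ≢ 0ℚ
diff-half-≢0 n k = ≢0-resp-≡ (begin
  ι k - ι n - half          ≡⟨ solve 2 (λ u v → u :- v :- con half := u :- (v :+ con 1ℚ) :+ con half) refl (ι k) (ι n) ⟩
  ι k - (ι n + 1ℚ) + half   ≡⟨ cong (λ z → ι k - z + half) (sym (ι-suc n)) ⟩
  ι k - ι (suc n) + half    ∎) (half-odd-≢0 k (suc n))
  where open ≡-Reasoning

diff-3/2-≢0 : ∀ n k → ι k - ι n - 3/2 ≢ 0ℚ
diff-3/2-≢0 n k = ≢0-resp-≡ (begin
  ι k - ι n - 3/2           ≡⟨ solve 2 (λ u v → u :- v :- con 3/2 := u :- (v :+ con 1ℚ) :- con half) refl (ι k) (ι n) ⟩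
  ι k - (ι n + 1ℚ) - half   ≡⟨ cong (λ z → ι k - z - half) (sym (ι-suc n)) ⟩
  ι k - ι (suc n) - half    ∎) (diff-half-≢0 (suc n) k)
  where open ≡-Reasoning

certDen-≢0 : ∀ n k → certDen (ι n) (ι k) ≢ 0ℚ
certDen-≢0 n k = *-≢0 (*-≢0 (sum-≢0 n k 1ℚ) (sum-≢0 n k 2ℚ)) (diff-3/2-≢0 n k)

contigP-≢0 : ∀ n k → contigP (ι n) (ι k) ≢ 0ℚ
contigP-≢0 n k = *-≢0 (*-≢0 (*-≢0 (*-≢0 (sum-≢0 n k 1ℚ) (sum-≢0 n k 2ℚ)) (nonNeg+pos≢0 (ι n) {{ι-nonNeg n}} 5/2))
                         (diff-3/2-≢0 n k)) (diff-half-≢0 n k)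

recA-≢0 : ∀ n → recA (ι n) ≢ 0ℚ
recA-≢0 n = *-≢0 (*-≢0 n+2≢0 n+2≢0) (nonNeg+pos≢0 (2ℚ * ι n) {{nonNeg*nonNeg⇒nonNeg 2ℚ (ι n) {{ι-nonNeg n}}}} 1ℚ)
  where
  n+2≢0 : ι n + 2ℚ ≢ 0ℚ
  n+2≢0 = nonNeg+pos≢0 (ι n) {{ι-nonNeg n}} 2ℚ

module Recurrence (n : ℕ) where

  x : ℚ
  x = ι n

  G : ℕ → ℚ
  G k = sgn k * certC x * cert x k

  wz-step : ∀ k → recA x * term (suc (suc n)) k - recC x * term n k ≡ G (suc k) - G k
  wz-step k = begin
    recA x * term (suc (suc n)) k - recC x * term n k
      ≡⟨ cong₂ (λ u v → recA x * u - recC x * v) term₂≡ (term≡V n k) ⟩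
    recA x * (s * w * V₂) - recC x * (s * w * V₀)
      ≡⟨ pull-sign (recA x) (recC x) (certC x) s w V₀ V₂ H H′ ⟩
    s * wz-defect x y V₀ V₂ H H′ + R
      ≡⟨ cong (λ z → s * z + R) defect≡0 ⟩
    s * 0ℚ + R
      ≡⟨ trans (cong (_+ R) (*-zeroʳ s)) (+-identityˡ R) ⟩
    R ∎
    where
    open ≡-Reasoning
    y = ι k
    s = sgn k
    w = weight y
    V₀ = V x k
    V₂ = V (x + 2ℚ) k
    H = cert x k
    H′ = cert x (suc k)
    R = (- s) * certC x * H′ - s * certC x * H
    term₂≡ : term (suc (suc n)) k ≡ s * w * V₂
    term₂≡ = trans (term≡V (suc (suc n)) k) (cong (λ z → s * w * V z k) (ι-+2 n))
    pull-sign : ∀ A C c s w V₀ V₂ H H′ →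
      A * (s * w * V₂) - C * (s * w * V₀) ≡ s * (A * w * V₂ - C * w * V₀ + c * H′ + c * H) + ((- s) * c * H′ - s * c * H)
    pull-sign = solve 9 (λ A C c s w V₀ V₂ H H′ →
      A :* (s :* w :* V₂) :- C :* (s :* w :* V₀) := s :* (A :* w :* V₂ :- C :* w :* V₀ :+ c :* H′ :+ c :* H) :+ ((:- s) :* c :* H′ :- s :* c :* H)) refl
    defect≡0 : wz-defect x y V₀ V₂ H H′ ≡ 0ℚ
    defect≡0 = wz-defect≡0 x y V₀ V₂ H H′ (contiguity n k)
      (cert-next x k (certDen-≢0 n (suc k)) (hypDen₂-≢0 n (suc k)) (hypDen₂-≢0 n k))
      (cert-now x k (certDen-≢0 n k) (hypDen₂-≢0 n k))
      (contigP-≢0 n k)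

  -- The certificate vanishes at both ends of the range: R(x,0) = 0 and (-x-2)_{n+3} = 0.
  G-start : G 0 ≡ 0ℚ
  G-start = trans (cong (sgn 0 * certC x *_) (0/?≡0 (certDen x (ι 0) * hypDen (x + 2ℚ) 0) (solve 2 (λ x N → con 0ℚ :* con 0ℚ :* con 0ℚ :* (con 0ℚ :+ x :+ con 5/2) :* N := con 0ℚ) refl x (hypNum (x + 2ℚ) 0))))
                  (*-zeroʳ (sgn 0 * certC x))

  G-end : G (suc (suc (suc n))) ≡ 0ℚ
  G-end = trans (cong (sgn K * certC x *_) (0/?≡0 (certDen x (ι K) * hypDen (x + 2ℚ) K) (trans (cong (certNum x (ι K) *_) (hypNum-vanish (x + 2ℚ) K poch-x₂≡0))
                                                            (*-zeroʳ (certNum x (ι K))))))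
                (*-zeroʳ (sgn K * certC x))
    where
    K = suc (suc (suc n))
    poch-x₂≡0 : poch (- (x + 2ℚ)) K ≡ 0ℚ
    poch-x₂≡0 = trans (cong (λ z → poch (- z) K) (sym (ι-+2 n))) (poch-vanish (suc (suc n)) 0)

  vanishing-step : sumTo n (term n) ≡ 0ℚ → sumTo (suc (suc n)) (term (suc (suc n))) ≡ 0ℚ
  vanishing-step Sₙ≡0 = *-cancelʳ-≢0 (recA x) (recA-≢0 n) (begin
    Sₙ₊₂ * recA x                                   ≡⟨ *-comm Sₙ₊₂ (recA x) ⟩
    recA x * Sₙ₊₂                                   ≡⟨ solve 2 (λ a c → a := a :- c :* con 0ℚ) refl (recA x * Sₙ₊₂) (recC x) ⟩
    recA x * Sₙ₊₂ - recC x * 0ℚ                     ≡⟨ cong (λ z → recA x * Sₙ₊₂ - recC x * z) (sym extended) ⟩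
    recA x * Sₙ₊₂ - recC x * sumTo (suc (suc n)) (term n)
                                                    ≡⟨ sum-telescope (suc (suc n)) (recA x) (recC x) (term (suc (suc n))) (term n) G wz-step ⟩
    G (suc (suc (suc n))) - G 0                     ≡⟨ cong₂ _-_ G-end G-start ⟩
    0ℚ - 0ℚ                                         ≡⟨ sym (*-zeroˡ (recA x)) ⟩
    0ℚ * recA x                                     ∎)
    where
    open ≡-Reasoning
    Sₙ₊₂ = sumTo (suc (suc n)) (term (suc (suc n)))
    -- Extending S(n) to k ≤ n+2 adds the vanishing summands t_n(n+1), t_n(n+2).
    extended : sumTo (suc (suc n)) (term n) ≡ 0ℚ
    extended = begin
      sumTo n (term n) + term n (suc n) + term n (suc (suc n))
        ≡⟨ cong₂ (λ u v → u + v + term n (suc (suc n))) Sₙ≡0 (term-vanish n (suc n) (poch-vanish n 0)) ⟩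
      0ℚ + 0ℚ + term n (suc (suc n))
        ≡⟨ cong (λ z → 0ℚ + 0ℚ + z) (term-vanish n (suc (suc n)) (poch-vanish n 1)) ⟩
      0ℚ ∎

mainTheorem3 : (m : ℕ) → let n = 2 ℕ.* m ℕ.+ 1 in sumTo n (term n) ≡ 0ℚ
mainTheorem3 zero    = refl
mainTheorem3 (suc m) = subst (λ n → sumTo n (term n) ≡ 0ℚ) (sym (cong (ℕ._+ 1) (ℕP.*-suc 2 m)))
                             (Recurrence.vanishing-step (2 ℕ.* m ℕ.+ 1) (mainTheorem3 m))
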